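{- Let $T=(V,E)$ be a tree of order at least three. Then for any $u\in V$ and any integer $t\ge 1$, the eccentricity of the vertex $u^t$ in $S(T,t)$ satisfies $$\epsilon(u^t)=(2^t-1)\,\epsilon(u)+(2^t-t-1)(D(T)-2),$$ where $\epsilon(u)$ is the eccentricity of $u$ in $T$ and $D(T)$ is the diameter of $T$.
   Context: For a graph $G=(V,E)$ and a positive integer $t$, $V^t$ denotes the set of words of length $t$ over the alphabet $V$, and $u^t$ denotes the word consisting of $t$ copies of the letter $u$. The generalized Sierpiński graph $S(G,t)$ has vertex set $V^t$ and edge set $\{\{w u_i u_j^{d-1}, w u_j u_i^{d-1}\} : \{u_i,u_j\}\in E,\ d\in\{1,\dots,t\},\ w\in V^{t-d}\}$. The eccentricity of a vertex is the maximum distance from it to any other vertex; the diameter $D(G)$ is the maximum eccentricity. -}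

module Defs where

open import Data.Nat using (ℕ; zero; suc; _≤_; _+_)
open import Data.Fin using (Fin)
open import Data.List using (List; []; _∷_; _++_; length; replicate)
open import Data.List.Relation.Unary.Unique.Propositional using (Unique)
open import Data.List.Relation.Unary.Linked using (Linked)
open import Data.Product using (Σ; ∃; ∃-syntax; _×_; _,_; proj₁)
open import Relation.Binary.PropositionalEquality using (_≡_)
open import Relation.Nullary using (¬_)

record Graph : Set₁ where
  field
    Vertex : Set
    Adj    : Vertex → Vertex → Set
open Graph public

data Walk (G : Graph) : Vertex G → Vertex G → ℕ → Set where
  here : ∀ {x} → Walk G x x 0
  step : ∀ {x y z k} → Adj G x y → Walk G y z k → Walk G x z (suc k)

Dist : (G : Graph) → Vertex G → Vertex G → ℕ → Set
Dist G x y d = Walk G x y d × (∀ k → Walk G x y k → d ≤ k)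

Ecc : (G : Graph) → Vertex G → ℕ → Set
Ecc G u e = (∀ v → ∃[ d ] (Dist G u v d × d ≤ e)) × (∃[ v ] Dist G u v e)

Diam : (G : Graph) → ℕ → Set
Diam G D = (∀ u v → ∃[ d ] (Dist G u v d × d ≤ D)) × (∃[ u ] ∃[ v ] Dist G u v D)

record SimpleGraph (n : ℕ) : Set₁ where
  field
    adj   : Fin n → Fin n → Set
    sym   : ∀ {x y} → adj x y → adj y x
    irrefl : ∀ {x} → ¬ adj x x

toGraph : ∀ {n} → SimpleGraph n → Graph
toGraph {n} G = record { Vertex = Fin n ; Adj = SimpleGraph.adj G }

Connected : Graph → Set
Connected G = ∀ x y → ∃[ k ] Walk G x y k

data LastAdjFirst {A : Set} (R : A → A → Set) : List A → Set where
  laf : ∀ v ws w → R w v → LastAdjFirst R (v ∷ (ws ++ (w ∷ [])))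

IsCycle : (G : Graph) → List (Vertex G) → Set
IsCycle G cs = (3 ≤ length cs) × Unique cs × Linked (Adj G) cs × LastAdjFirst (Adj G) cs

Acyclic : Graph → Set
Acyclic G = ∀ cs → ¬ IsCycle G cs

IsTree : ∀ {n} → SimpleGraph n → Set
IsTree T = Connected (toGraph T) × Acyclic (toGraph T)

Word : ℕ → ℕ → Set
Word n t = Σ (List (Fin n)) (λ w → length w ≡ t)

-- Generalized Sierpiński graph S(G,t): {w ui uj^(d-1), w uj ui^(d-1)} with d = k+1.
SAdj : ∀ {n} → SimpleGraph n → (t : ℕ) → Word n t → Word n t → Set
SAdj {n} G t x y =
  ∃[ w ] ∃[ ui ] ∃[ uj ] ∃[ k ]
    (SimpleGraph.adj G ui uj ×
     proj₁ x ≡ w ++ (ui ∷ replicate k uj) ×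
     proj₁ y ≡ w ++ (uj ∷ replicate k ui))

Sierpinski : ∀ {n} → SimpleGraph n → ℕ → Graph
Sierpinski {n} G t = record { Vertex = Word n t ; Adj = SAdj G t }

constWord : ∀ {n} → Fin n → (t : ℕ) → Word n t
constWord u t = replicate t u , Data.List.Properties.length-replicate t
  where import Data.List.Properties

-- Root T at u. The distance in S(T,t) from u^t to a word a x is computed letter by letter: if a = u
-- it is the distance to x one level down; otherwise, with p the neighbour of a towards u, the walk
-- u^{t+1} → p^{t+1} → p a^t → a p^t → a x is shortest, because this candidate distance changes by at most
-- one along every edge of S(T,t). Bounding it uses that every non-leaf of a tree has eccentricity
-- below D, and the bound is attained at the word a w a w …, where a is farthest from u and w farthest
-- from a: in a tree, a vertex farthest from any vertex is an end of a diametral path.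
module Submission where

open import Defs
open import Data.Nat using (ℕ; zero; suc; _≤_; _<_; _+_; _*_; _∸_; _^_; z≤n; s≤s; _≟_; _≤?_)
open import Data.Nat.Properties
open import Data.Nat.Tactic.RingSolver using (solve-∀)
open import Data.Fin using (Fin; zero; suc)
open import Data.Fin.Properties using () renaming (_≟_ to _≟ᶠ_)
open import Data.List using (List; []; _∷_; _++_; length; replicate)
open import Data.List.Properties using (length-replicate; length-++-comm)
open import Data.List.Relation.Unary.All as All using (All; []; _∷_)
open import Data.List.Relation.Unary.All.Properties using (++⁺)
open import Data.List.Relation.Unary.AllPairs using ([]; _∷_)
open import Data.List.Relation.Unary.Unique.Propositional using (Unique)
open import Data.List.Relation.Unary.Linked using (Linked; [-]; _∷_)
open import Data.Product using (Σ; ∃-syntax; _×_; _,_; proj₁; proj₂)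
open import Data.Sum using (_⊎_; inj₁; inj₂)
open import Data.Empty using (⊥-elim)
open import Relation.Nullary using (¬_; Dec; yes; no)
open import Relation.Nullary.Decidable using (_×-dec_)
open import Relation.Binary.Definitions using (tri<; tri≈; tri>)
open import Relation.Binary.PropositionalEquality

module Walks (G : Graph) where

  _▷_ : ∀ {x y z k} → Walk G x y k → Adj G y z → Walk G x z (suc k)
  here     ▷ e = step e here
  step a w ▷ e = step a (w ▷ e)

  _++ʷ_ : ∀ {x y z k j} → Walk G x y k → Walk G y z j → Walk G x z (k + j)
  here     ++ʷ v = v
  step e w ++ʷ v = step e (w ++ʷ v)

  castʷ : ∀ {x y k j} → k ≡ j → Walk G x y k → Walk G x y j
  castʷ refl w = w

  walk₀⇒≡ : ∀ {x y} → Walk G x y 0 → x ≡ y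
  walk₀⇒≡ here = refl

  walk₁⇒adj : ∀ {x y} → Walk G x y 1 → Adj G x y
  walk₁⇒adj (step e here) = e

  unsnoc : ∀ {x y k} → Walk G x y (suc k) → ∃[ z ] (Adj G z y × Walk G x z k)
  unsnoc (step e here) = _ , e , here
  unsnoc (step e (step e′ w)) with unsnoc (step e′ w)
  ... | z , a , w′ = z , a , step e w′

module Lists {A : Set} where

  unique-∷ʳ : ∀ {xs} {y : A} → Unique xs → All (_≢ y) xs → Unique (xs ++ y ∷ [])
  unique-∷ʳ []       []       = [] ∷ []
  unique-∷ʳ (p ∷ ps) (q ∷ qs) = ++⁺ p (q ∷ []) ∷ unique-∷ʳ ps qs

  linked-∷ʳ : ∀ {R : A → A → Set} xs {b c : A} →
              Linked R (xs ++ b ∷ []) → R b c → Linked R ((xs ++ b ∷ []) ++ c ∷ [])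
  linked-∷ʳ []           l        r = r ∷ [-]
  linked-∷ʳ (x ∷ [])     (r′ ∷ l) r = r′ ∷ linked-∷ʳ [] l r
  linked-∷ʳ (x ∷ y ∷ xs) (r′ ∷ l) r = r′ ∷ linked-∷ʳ (y ∷ xs) l r

module Distance {n : ℕ} (G : SimpleGraph n) {D : ℕ} (diam : Diam (toGraph G) D) where

  open SimpleGraph G public using (adj) renaming (sym to adj-sym; irrefl to adj-irrefl)
  open Walks (toGraph G) public

  V : Set
  V = Fin n

  dist : V → V → ℕ
  dist u v = proj₁ (proj₁ diam u v)

  geodesic : ∀ u v → Walk (toGraph G) u v (dist u v)
  geodesic u v = proj₁ (proj₁ (proj₂ (proj₁ diam u v)))

  dist-minimal : ∀ {u v k} → Walk (toGraph G) u v k → dist u v ≤ k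
  dist-minimal {u} {v} {k} w = proj₂ (proj₁ (proj₂ (proj₁ diam u v))) k w

  dist≤D : ∀ u v → dist u v ≤ D
  dist≤D u v = proj₂ (proj₂ (proj₁ diam u v))

  Dist⇒dist≡ : ∀ {x y k} → Dist (toGraph G) x y k → dist x y ≡ k
  Dist⇒dist≡ {x} {y} (w , minimal) = ≤-antisym (dist-minimal w) (minimal (dist x y) (geodesic x y))

  reverse : ∀ {x y k} → Walk (toGraph G) x y k → Walk (toGraph G) y x k
  reverse here       = here
  reverse (step e w) = reverse w ▷ adj-sym e

  dist-refl : ∀ u → dist u u ≡ 0
  dist-refl u = n≤0⇒n≡0 (dist-minimal here)

  dist≡0⇒≡ : ∀ {u v} → dist u v ≡ 0 → u ≡ v
  dist≡0⇒≡ {u} {v} eq = walk₀⇒≡ (castʷ eq (geodesic u v))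

  dist-step : ∀ {u x y} → adj x y → dist u y ≤ suc (dist u x)
  dist-step {u} {x} e = dist-minimal (geodesic u x ▷ e)

  dist-triangle : ∀ u x y → dist u y ≤ dist u x + dist x y
  dist-triangle u x y = dist-minimal (geodesic u x ++ʷ geodesic x y)

  dist-sym : ∀ u v → dist u v ≡ dist v u
  dist-sym u v = ≤-antisym (dist-minimal (reverse (geodesic v u))) (dist-minimal (reverse (geodesic u v)))

  adj⇒dist≡1 : ∀ {x y} → adj x y → dist x y ≡ 1
  adj⇒dist≡1 {x} {y} e with dist x y in eq | dist-minimal (step e here)
  ... | zero        | _ = ⊥-elim (adj-irrefl (subst (adj x) (sym (dist≡0⇒≡ eq)) e))
  ... | suc zero    | _ = refl
  ... | suc (suc _) | s≤s ()

  dist≡1⇒adj : ∀ {x y} → dist x y ≡ 1 → adj x y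
  dist≡1⇒adj {x} {y} eq = walk₁⇒adj (castʷ eq (geodesic x y))

  penultimate : ∀ {x y} k → Walk (toGraph G) x y k → V
  penultimate {x} zero    _ = x
  penultimate     (suc k) w = proj₁ (unsnoc w)

  penultimate-spec : ∀ {x y} k (w : Walk (toGraph G) x y k) {m} → k ≡ suc m →
                     adj (penultimate k w) y × Walk (toGraph G) x (penultimate k w) m
  penultimate-spec (suc k) w refl = proj₂ (unsnoc w)

  -- The neighbour of a on a fixed geodesic from u; it is a itself when a = u.
  parent : V → V → V
  parent u a = penultimate (dist u a) (geodesic u a)

  parent-adj : ∀ u a {m} → dist u a ≡ suc m → adj (parent u a) a
  parent-adj u a eq = proj₁ (penultimate-spec (dist u a) (geodesic u a) eq)

  parent-dist : ∀ u a {m} → dist u a ≡ suc m → dist u (parent u a) ≡ m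
  parent-dist u a {m} eq =
    ≤-antisym (dist-minimal (proj₂ (penultimate-spec (dist u a) (geodesic u a) eq)))
              (≤-pred (subst (_≤ suc (dist u (parent u a))) eq (dist-step (parent-adj u a eq))))

  parent-root : ∀ u a → dist u a ≡ 0 → parent u a ≡ u
  parent-root u a eq with dist u a | geodesic u a
  parent-root u a refl | zero | _ = refl

  dist-parent : ∀ u a → dist u (parent u a) ≡ dist u a ∸ 1
  dist-parent u a = by-cases (dist u a) refl
    where
      by-cases : ∀ k → dist u a ≡ k → dist u (parent u a) ≡ k ∸ 1
      by-cases zero    eq = trans (cong (dist u) (parent-root u a eq)) (dist-refl u)
      by-cases (suc m) eq = parent-dist u a eq

module TreeDistance {n : ℕ} (G : SimpleGraph n) (acyclic : Acyclic (toGraph G))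
                    {D : ℕ} (diam : Diam (toGraph G) D) where

  open Distance G diam public
  open Lists

  Ball : V → ℕ → List V → Set
  Ball u m = All (λ z → dist u z ≤ m)

  BallPath : V → ℕ → V → V → Set
  BallPath u m x y = ∃[ mid ] let path = x ∷ mid ++ y ∷ [] in
    1 ≤ length mid × Unique path × Linked adj path × Ball u m path

  outside-ball : ∀ {u a m L} → dist u a ≡ suc m → Ball u m L → All (_≢ a) L
  outside-ball {u} {a} {m} eq = All.map λ le z≡a → 1+n≰n (subst (_≤ m) (trans (cong (dist u) z≡a) eq) le)

  -- Follow the parent chains of x and y towards u until they meet.
  ballPath : ∀ u m x y → dist u x ≡ m → dist u y ≡ m → x ≢ y → BallPath u m x y
  ballPath u zero x y ex ey x≢y = ⊥-elim (x≢y (trans (sym (dist≡0⇒≡ ex)) (dist≡0⇒≡ ey)))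
  ballPath u (suc m) x y ex ey x≢y with parent u x ≟ᶠ parent u y
  ... | yes same =
    (px ∷ []) , s≤s z≤n ,
    ((x≢px ∷ x≢y ∷ []) ∷ (px≢y ∷ []) ∷ [] ∷ []) ,
    (adj-sym (parent-adj u x ex) ∷ subst (λ z → adj z y) (sym same) (parent-adj u y ey) ∷ [-]) ,
    (≤-reflexive ex ∷ m≤n⇒m≤1+n (≤-reflexive dpx) ∷ ≤-reflexive ey ∷ [])
    where
      px = parent u x
      dpx = parent-dist u x ex
      x≢px : x ≢ px
      x≢px eq = 1+n≰n (subst (_≤ m) (trans (cong (dist u) (sym eq)) ex) (≤-reflexive dpx))
      px≢y : px ≢ y
      px≢y eq = 1+n≰n (subst (_≤ m) (trans (cong (dist u) eq) ey) (≤-reflexive dpx))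
  ... | no px≢py with ballPath u m (parent u x) (parent u y) (parent-dist u x ex) (parent-dist u y ey) px≢py
  ...   | mid , _ , unique , linked , ball =
    (parent u x ∷ mid ++ parent u y ∷ []) , s≤s z≤n ,
    (++⁺ (All.map (λ ne eq → ne (sym eq)) (outside-ball ex ball)) (x≢y ∷ []) ∷ unique-∷ʳ unique (outside-ball ey ball)) ,
    (adj-sym (parent-adj u x ex) ∷ linked-∷ʳ (parent u x ∷ mid) linked (parent-adj u y ey)) ,
    (≤-reflexive ex ∷ ++⁺ (All.map m≤n⇒m≤1+n ball) (≤-reflexive ey ∷ []))

  adj⇒dist≢ : ∀ u {x y} → adj x y → dist u x ≢ dist u y
  adj⇒dist≢ u {x} {y} e eq with ballPath u (dist u x) x y refl (sym eq) (λ x≡y → adj-irrefl (subst (adj x) (sym x≡y) e))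
  ... | mid , 1≤mid , unique , linked , _ =
    acyclic (x ∷ mid ++ y ∷ []) (length≥3 , unique , linked , laf x mid y (adj-sym e))
    where
      length≥3 : 3 ≤ length (x ∷ mid ++ y ∷ [])
      length≥3 rewrite length-++-comm mid (y ∷ []) = s≤s (s≤s 1≤mid)

  parent-unique : ∀ u {p q a} m → adj p a → adj q a →
                  dist u p ≡ m → dist u q ≡ m → dist u a ≡ suc m → p ≡ q
  parent-unique u {p} {q} {a} m ep eq dp dq da with p ≟ᶠ q
  ... | yes p≡q = p≡q
  ... | no p≢q with ballPath u m p q dp dq p≢q
  ...   | mid , _ , unique , linked , ball =
    ⊥-elim (acyclic (p ∷ (mid ++ q ∷ []) ++ a ∷ [])
      (length≥3 , unique-∷ʳ unique (outside-ball da ball) , linked-∷ʳ (p ∷ mid) linked eq ,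
       laf p (mid ++ q ∷ []) a (adj-sym ep)))
    where
      length≥3 : 3 ≤ length (p ∷ (mid ++ q ∷ []) ++ a ∷ [])
      length≥3 rewrite length-++-comm (mid ++ q ∷ []) (a ∷ []) | length-++-comm mid (q ∷ []) = s≤s (s≤s (s≤s z≤n))

  edge-orientation : ∀ u {a b} → adj a b →
    (dist u a ≡ suc (dist u b) × parent u a ≡ b) ⊎ (dist u b ≡ suc (dist u a) × parent u b ≡ a)
  edge-orientation u {a} {b} e with <-cmp (dist u a) (dist u b)
  ... | tri≈ _ eq _ = ⊥-elim (adj⇒dist≢ u e eq)
  ... | tri< lt _ _ = inj₂ (db , parent-unique u (dist u a) (parent-adj u b db) e (parent-dist u b db) refl db)
    where db = ≤-antisym (dist-step e) lt
  ... | tri> _ _ gt = inj₁ (da , parent-unique u (dist u b) (parent-adj u a da) (adj-sym e) (parent-dist u a da) refl da)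
    where da = ≤-antisym (dist-step (adj-sym e)) gt

  farthest-neighbour : ∀ {z y q} → (∀ x → dist z x ≤ dist z y) → adj q y →
                       dist z y ≡ suc (dist z q) × parent z y ≡ q
  farthest-neighbour {z} {y} {q} farthest e with edge-orientation z e
  ... | inj₁ (dq , _) = ⊥-elim (1+n≰n (subst (_≤ dist z y) dq (farthest q)))
  ... | inj₂ oriented = oriented

  farthest-is-leaf : ∀ {z y q₁ q₂} → (∀ x → dist z x ≤ dist z y) → adj q₁ y → adj q₂ y → q₁ ≡ q₂
  farthest-is-leaf farthest e₁ e₂ =
    trans (sym (proj₂ (farthest-neighbour farthest e₁))) (proj₂ (farthest-neighbour farthest e₂))

  internal⇒dist<D : ∀ {v q₁ q₂} → adj q₁ v → adj q₂ v → q₁ ≢ q₂ → ∀ z → dist v z < D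
  internal⇒dist<D {v} e₁ e₂ q₁≢q₂ z = ≤∧≢⇒< (dist≤D v z) λ dvz≡D →
    q₁≢q₂ (farthest-is-leaf (λ x → subst (dist z x ≤_) (trans (sym dvz≡D) (dist-sym v z)) (dist≤D z x)) e₁ e₂)

  distinct⇒dist≡1 : ∀ {a b} → a ≢ b → D ≤ 1 → dist a b ≡ 1
  distinct⇒dist≡1 {a} {b} a≢b D≤1 with dist a b in eq | ≤-trans (dist≤D a b) D≤1
  ... | zero        | _ = ⊥-elim (a≢b (dist≡0⇒≡ eq))
  ... | suc zero    | _ = refl
  ... | suc (suc _) | s≤s ()

  -- Three pairwise adjacent vertices would form an odd cycle.
  three-distinct⇒2≤D : ∀ {x y z} → x ≢ y → x ≢ z → y ≢ z → 2 ≤ D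
  three-distinct⇒2≤D {x} x≢y x≢z y≢z with 2 ≤? D
  ... | yes 2≤D = 2≤D
  ... | no 2≰D = ⊥-elim (adj⇒dist≢ x (dist≡1⇒adj (distinct⇒dist≡1 y≢z D≤1))
                          (trans (distinct⇒dist≡1 x≢y D≤1) (sym (distinct⇒dist≡1 x≢z D≤1))))
    where D≤1 = ≤-pred (≰⇒> 2≰D)

  module Rooted (u : V) where

    depth : V → ℕ
    depth = dist u

    ancestor : ℕ → V → V
    ancestor zero    x = x
    ancestor (suc j) x = ancestor j (parent u x)

    depth-ancestor : ∀ j x → depth (ancestor j x) ≡ depth x ∸ j
    depth-ancestor zero    x = refl
    depth-ancestor (suc j) x =
      trans (depth-ancestor j (parent u x)) (trans (cong (_∸ j) (dist-parent u x)) (∸-+-assoc (depth x) 1 j))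

    ancestor-suc : ∀ j x → ancestor (suc j) x ≡ parent u (ancestor j x)
    ancestor-suc zero    x = refl
    ancestor-suc (suc j) x = ancestor-suc j (parent u x)

    climb : ∀ j x → j ≤ depth x → Walk (toGraph G) x (ancestor j x) j
    climb zero    x _  = here
    climb (suc j) x le =
      step (adj-sym (parent-adj u x eq)) (climb j (parent u x) (subst (j ≤_) (sym (parent-dist u x eq)) j≤m))
      where
        eq : depth x ≡ suc (depth x ∸ 1)
        eq = sym (m+[n∸m]≡n (≤-trans (s≤s z≤n) le))
        j≤m = ≤-pred (≤-trans le (≤-reflexive eq))

    ancestor-depth : ∀ x → ancestor (depth x) x ≡ u
    ancestor-depth x = sym (dist≡0⇒≡ (trans (depth-ancestor (depth x) x) (n∸n≡0 (depth x))))

    InSubtree : V → V → Set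
    InSubtree x c = depth x ≤ depth c × ancestor (depth c ∸ depth x) c ≡ x

    inSubtree? : ∀ x c → Dec (InSubtree x c)
    inSubtree? x c = (depth x ≤? depth c) ×-dec (ancestor (depth c ∸ depth x) c ≟ᶠ x)

    root-subtree : ∀ v → InSubtree u v
    root-subtree v rewrite dist-refl u = z≤n , ancestor-depth v

    subtree-top : ∀ {x c} → InSubtree x c → depth c ≡ depth x → c ≡ x
    subtree-top {x} {c} (_ , anc) eq = trans (cong (λ j → ancestor j c) (sym gap≡0)) anc
      where gap≡0 = trans (cong (_∸ depth x) eq) (n∸n≡0 (depth x))

    descend : ∀ {x c c₁} → InSubtree x c → depth c₁ ≡ suc (depth c) → parent u c₁ ≡ c →
              depth c₁ ∸ depth x ≡ suc (depth c ∸ depth x) × InSubtree x c₁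
    descend {x} {c} {c₁} (le , anc) dc₁ pc₁ =
      gap , ≤-trans le (≤-trans (n≤1+n _) (≤-reflexive (sym dc₁))) ,
      trans (cong (λ j → ancestor j c₁) gap) (trans (cong (ancestor (depth c ∸ depth x)) pc₁) anc)
      where gap = trans (cong (_∸ depth x) dc₁) (+-∸-assoc 1 le)

    ascend : ∀ {x c c₁} → InSubtree x c → depth c ≢ depth x → depth c ≡ suc (depth c₁) → parent u c ≡ c₁ →
             depth c ∸ depth x ≡ suc (depth c₁ ∸ depth x) × InSubtree x c₁
    ascend {x} {c} {c₁} (le , anc) ne dc pc =
      gap , le₁ ,
      trans (cong (ancestor (depth c₁ ∸ depth x)) (sym pc)) (trans (cong (λ j → ancestor j c) (sym gap)) anc)
      where
        le₁ = ≤-pred (≤-trans (≤∧≢⇒< le (≢-sym ne)) (≤-reflexive dc))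
        gap = trans (cong (_∸ depth x) dc) (+-∸-assoc 1 le₁)

    -- A walk out of the subtree of x must pass through the parent of x.
    leave-subtree : ∀ {x c w k} → InSubtree x c → ¬ InSubtree x w → Walk (toGraph G) c w k →
                    depth c ∸ depth x + dist (parent u x) w < k
    leave-subtree c∈ w∉ here = ⊥-elim (w∉ c∈)
    leave-subtree {x} {c} {w} {suc k} c∈ w∉ (step e rest) with edge-orientation u e
    ... | inj₂ (dc₁ , pc₁) =
      m<n⇒m<1+n (<-trans (n<1+n _) (subst (λ g → g + dist (parent u x) w < k) gap (leave-subtree c₁∈ w∉ rest)))
      where open Σ (descend c∈ dc₁ pc₁) renaming (proj₁ to gap; proj₂ to c₁∈)
    ... | inj₁ (dc , pc) with depth c ≟ depth x
    ... | no ne = subst (λ g → g + dist (parent u x) w < suc k) (sym gap) (s≤s (leave-subtree c₁∈ w∉ rest))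
      where open Σ (ascend c∈ ne dc pc) renaming (proj₁ to gap; proj₂ to c₁∈)
    ... | yes eq =
      s≤s (subst (λ g → g + dist (parent u x) w ≤ k) (sym gap≡0)
                 (subst (λ v → dist v w ≤ k) (sym px≡c₁) (dist-minimal rest)))
      where
        gap≡0 = trans (cong (_∸ depth x) eq) (n∸n≡0 (depth x))
        px≡c₁ = trans (cong (parent u) (sym (subtree-top c∈ eq))) pc

    gap-ancestor : ∀ j a → j ≤ depth a → depth a ∸ depth (ancestor j a) ≡ j
    gap-ancestor j a le = trans (cong (depth a ∸_) (depth-ancestor j a)) (m∸[m∸n]≡n le)

    ancestor-subtree : ∀ j a → j ≤ depth a → InSubtree (ancestor j a) a
    ancestor-subtree j a le =
      subst (_≤ depth a) (sym (depth-ancestor j a)) (m∸n≤m (depth a) j) ,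
      cong (λ i → ancestor i a) (gap-ancestor j a le)

    module _ {a : V} (farthest : ∀ v → depth v ≤ depth a) where

      -- The geodesic from a to z leaves the subtree of the j-th ancestor of a, hence passes
      -- through the (j+1)-th one, which is within distance j + 1 of every vertex below it.
      leaving-bound : ∀ j y z → suc j ≤ depth a → InSubtree (ancestor (suc j) a) y →
                      ¬ InSubtree (ancestor j a) z → dist y z ≤ dist a z
      leaving-bound j y z le (_ , anc) z∉ = begin
        dist y z                                   ≤⟨ dist-triangle y X z ⟩
        dist y X + dist X z                        ≤⟨ +-monoˡ-≤ (dist X z) y→X ⟩
        suc j + dist X z                           ≡⟨ cong (λ v → suc j + dist v z) (ancestor-suc j a) ⟩
        suc (j + dist (parent u (ancestor j a)) z) ≤⟨ a→z ⟩
        dist a z                                   ∎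
        where
          open ≤-Reasoning
          X = ancestor (suc j) a
          a→z : j + dist (parent u (ancestor j a)) z < dist a z
          a→z = subst (λ g → g + dist (parent u (ancestor j a)) z < dist a z) (gap-ancestor j a j≤depth)
                      (leave-subtree (ancestor-subtree j a j≤depth) z∉ (geodesic a z))
            where j≤depth = ≤-trans (n≤1+n j) le
          y→X : dist y X ≤ suc j
          y→X = begin
            dist y X                                 ≡⟨ cong (dist y) (sym anc) ⟩
            dist y (ancestor (depth y ∸ depth X) y)  ≤⟨ dist-minimal (climb _ y (m∸n≤m (depth y) (depth X))) ⟩
            depth y ∸ depth X                        ≤⟨ ∸-monoˡ-≤ (depth X) (farthest y) ⟩
            depth a ∸ depth X                        ≡⟨ gap-ancestor (suc j) a le ⟩
            suc j                                    ∎

      dominates-below : ∀ j y z → j ≤ depth a → InSubtree (ancestor j a) y → InSubtree (ancestor j a) z →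
                        dist y z ≤ dist a y ⊎ dist y z ≤ dist a z
      dominates-below zero y z _ y∈ _ =
        inj₂ (≤-reflexive (cong (λ v → dist v z) (subtree-top y∈ (≤-antisym (farthest y) (proj₁ y∈)))))
      dominates-below (suc j) y z le y∈ z∈ with inSubtree? (ancestor j a) y | inSubtree? (ancestor j a) z
      ... | yes y∈′ | yes z∈′ = dominates-below j y z (≤-trans (n≤1+n j) le) y∈′ z∈′
      ... | _       | no z∉   = inj₂ (leaving-bound j y z le y∈ z∉)
      ... | no y∉   | yes _   = inj₁ (subst (_≤ dist a y) (dist-sym z y) (leaving-bound j z y le z∈ y∉))

      farthest-dominates : ∀ y z → dist y z ≤ dist a y ⊎ dist y z ≤ dist a z
      farthest-dominates y z = dominates-below (depth a) y z ≤-refl (everything y) (everything z)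
        where
          everything : ∀ v → InSubtree (ancestor (depth a) a) v
          everything v = subst (λ r → InSubtree r v) (sym (ancestor-depth a)) (root-subtree v)

  farthest-is-peripheral : ∀ {u a} → (∀ v → dist u v ≤ dist u a) → ∃[ w ] dist a w ≡ D
  farthest-is-peripheral {u} {a} farthest with proj₂ diam
  ... | y , z , y-z with Rooted.farthest-dominates u farthest y z
  ...   | inj₁ le = y , ≤-antisym (dist≤D a y) (subst (_≤ dist a y) (Dist⇒dist≡ y-z) le)
  ...   | inj₂ le = z , ≤-antisym (dist≤D a z) (subst (_≤ dist a z) (Dist⇒dist≡ y-z) le)

-- M t = 2^t − 1 is the distance between u^t and v^t for adjacent u, v, and N t = 2^t − t − 1.
M : ℕ → ℕ
M zero    = 0
M (suc t) = suc (M t + M t)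

N : ℕ → ℕ
N zero    = 0
N (suc t) = N t + M t

M-mono : ∀ t → M t ≤ M (suc t)
M-mono t = m≤n⇒m≤1+n (m≤m+n (M t) (M t))

N-mono : ∀ t → N t ≤ N (suc t)
N-mono t = m≤m+n (N t) (M t)

M-N-step : ∀ t m D′ → M (suc t) * m + suc (M t) + (M t * suc D′ + N t * D′) ≡ M (suc t) * suc m + N (suc t) * D′
M-N-step t m D′ = identity (M t) (N t) m D′
  where
    identity : ∀ a q m D′ → (1 + a + a) * m + (1 + a) + (a * (1 + D′) + q * D′)
                          ≡ (1 + a + a) * (1 + m) + (q + a) * D′
    identity = solve-∀

M-N-step-≤ : ∀ t m D′ r → M (suc t) * m + suc (M t) + (M t * (2 + D′) + N t * D′)
                          ≤ M (suc t) * (2 + m + r) + N (suc t) * D′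
M-N-step-≤ t m D′ r = begin
  M (suc t) * m + suc (M t) + (M t * (2 + D′) + N t * D′)
    ≤⟨ m≤m+n _ (M t + 1 + M (suc t) * r) ⟩
  M (suc t) * m + suc (M t) + (M t * (2 + D′) + N t * D′) + (M t + 1 + M (suc t) * r)
    ≡⟨ identity (M t) (N t) m D′ r ⟩
  M (suc t) * (2 + m + r) + N (suc t) * D′
    ∎
  where
    open ≤-Reasoning
    identity : ∀ a q m D′ r → (1 + a + a) * m + (1 + a) + (a * (2 + D′) + q * D′) + (a + 1 + (1 + a + a) * r)
                            ≡ (1 + a + a) * (2 + m + r) + (q + a) * D′
    identity = solve-∀

1+M≡2^ : ∀ t → suc (M t) ≡ 2 ^ t
1+M≡2^ zero    = refl
1+M≡2^ (suc t) = begin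
  suc (suc (M t + M t))       ≡⟨ cong suc (sym (+-suc (M t) (M t))) ⟩
  suc (M t) + suc (M t)       ≡⟨ cong₂ _+_ (1+M≡2^ t) (1+M≡2^ t) ⟩
  2 ^ t + 2 ^ t               ≡⟨ cong (2 ^ t +_) (sym (+-identityʳ (2 ^ t))) ⟩
  2 ^ suc t                   ∎
  where open ≡-Reasoning

N+1+t≡2^ : ∀ t → N t + suc t ≡ 2 ^ t
N+1+t≡2^ zero    = refl
N+1+t≡2^ (suc t) = begin
  N t + M t + (2 + t)              ≡⟨ identity (N t) (M t) t ⟩
  (N t + suc t) + suc (M t)        ≡⟨ cong₂ _+_ (N+1+t≡2^ t) (1+M≡2^ t) ⟩
  2 ^ t + 2 ^ t                    ≡⟨ cong (2 ^ t +_) (sym (+-identityʳ (2 ^ t))) ⟩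
  2 ^ suc t                        ∎
  where
    open ≡-Reasoning
    identity : ∀ q a t → q + a + (2 + t) ≡ (q + (1 + t)) + (1 + a)
    identity = solve-∀

M≡2^∸1 : ∀ t → M t ≡ 2 ^ t ∸ 1
M≡2^∸1 t = cong (_∸ 1) (1+M≡2^ t)

N≡2^∸t∸1 : ∀ t → N t ≡ 2 ^ t ∸ t ∸ 1
N≡2^∸t∸1 t = sym (begin
  2 ^ t ∸ t ∸ 1           ≡⟨ ∸-+-assoc (2 ^ t) t 1 ⟩
  2 ^ t ∸ (t + 1)         ≡⟨ cong₂ _∸_ (sym (N+1+t≡2^ t)) (+-comm t 1) ⟩
  N t + suc t ∸ suc t     ≡⟨ m+n∸n≡m (N t) (suc t) ⟩
  N t                     ∎)
  where open ≡-Reasoning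

module SierpinskiDistance {n : ℕ} (G : SimpleGraph n) (acyclic : Acyclic (toGraph G))
                          {D : ℕ} (diam : Diam (toGraph G) D) where

  open TreeDistance G acyclic diam

  -- With p = parent u a: u^{t+1} → p^{t+1} → p a^t → a p^t → a x, at cost
  -- M (t+1) · dist u p + M t + 1 + sdist p x.
  consCost : ℕ → ℕ → ℕ → ℕ → ℕ
  consCost zero    t stay _    = stay
  consCost (suc m) t _    move = M (suc t) * m + suc (M t) + move

  sdist : V → List V → ℕ
  sdist u []      = 0
  sdist u (a ∷ x) = consCost (dist u a) (length x) (sdist u x) (sdist (parent u a) x)

  sdist-∷ : ∀ {u a m t} x → length x ≡ t → dist u a ≡ suc m →
            sdist u (a ∷ x) ≡ M (suc t) * m + suc (M t) + sdist (parent u a) x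
  sdist-∷ x refl eq = consCost-suc eq
    where
      consCost-suc : ∀ {k m t stay move} → k ≡ suc m → consCost k t stay move ≡ M (suc t) * m + suc (M t) + move
      consCost-suc refl = refl

  sdist-∷-root : ∀ {u a} x → dist u a ≡ 0 → sdist u (a ∷ x) ≡ sdist u x
  sdist-∷-root x eq = consCost-zero eq
    where
      consCost-zero : ∀ {k t stay move} → k ≡ 0 → consCost k t stay move ≡ stay
      consCost-zero refl = refl

  sdist-replicate : ∀ t v w → sdist v (replicate t w) ≡ M t * dist v w
  sdist-replicate zero    v w = refl
  sdist-replicate (suc t) v w
    rewrite length-replicate t {w} | sdist-replicate t v w | sdist-replicate t (parent v w) w =
    by-cases (dist v w) refl
    where
      by-cases : ∀ k → dist v w ≡ k → consCost k t (M t * k) (M t * dist (parent v w) w) ≡ M (suc t) * k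
      by-cases zero    _  = trans (*-zeroʳ (M t)) (sym (*-zeroʳ (M (suc t))))
      by-cases (suc m) eq rewrite adj⇒dist≡1 (parent-adj v w eq) = identity (M t) m
        where
          identity : ∀ a m → (1 + a + a) * m + (1 + a) + a * 1 ≡ (1 + a + a) * (1 + m)
          identity = solve-∀

  dist-grandchild : ∀ u {a b m} → adj a b → dist u a ≡ suc (dist u b) → dist u b ≡ suc m →
                    dist (parent u b) a ≡ 2
  dist-grandchild u {a} {b} {m} e da db = ≤-antisym (dist-minimal (step (parent-adj u b db) (step (adj-sym e) here)))
    (+-cancelˡ-≤ m 2 _ (begin
      m + 2                                     ≡⟨ +-comm m 2 ⟩
      2 + m                                     ≡⟨ sym (trans da (cong suc db)) ⟩
      dist u a                                  ≤⟨ dist-triangle u (parent u b) a ⟩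
      dist u (parent u b) + dist (parent u b) a ≡⟨ cong (_+ dist (parent u b) a) (parent-dist u b db) ⟩
      m + dist (parent u b) a                   ∎))
    where open ≤-Reasoning

  sdist-cross : ∀ u {a b} k → adj a b → dist u a ≡ suc (dist u b) → parent u a ≡ b →
                sdist u (a ∷ replicate k b) ≡ suc (sdist u (b ∷ replicate k a))
  sdist-cross u {a} {b} k e da pa = by-cases (dist u b) refl
    where
      open ≡-Reasoning
      towards-root : sdist u (a ∷ replicate k b) ≡ M (suc k) * dist u b + suc (M k)
      towards-root rewrite sdist-∷ (replicate k b) (length-replicate k) da | pa
                         | sdist-replicate k b b | dist-refl b | *-zeroʳ (M k) = +-identityʳ _
      by-cases : ∀ m → dist u b ≡ m → sdist u (a ∷ replicate k b) ≡ suc (sdist u (b ∷ replicate k a))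
      by-cases zero db = begin
        sdist u (a ∷ replicate k b)        ≡⟨ towards-root ⟩
        M (suc k) * dist u b + suc (M k)   ≡⟨ cong (λ d → M (suc k) * d + suc (M k)) db ⟩
        M (suc k) * 0 + suc (M k)          ≡⟨ identity (M k) ⟩
        suc (M k * 1)                      ≡⟨ cong (λ d → suc (M k * d)) (sym (trans da (cong suc db))) ⟩
        suc (M k * dist u a)               ≡⟨ cong suc (sym (sdist-replicate k u a)) ⟩
        suc (sdist u (replicate k a))      ≡⟨ cong suc (sym (sdist-∷-root (replicate k a) db)) ⟩
        suc (sdist u (b ∷ replicate k a))  ∎
        where
          identity : ∀ a → (1 + a + a) * 0 + (1 + a) ≡ 1 + a * 1
          identity = solve-∀
      by-cases (suc m) db = begin
        sdist u (a ∷ replicate k b)                                   ≡⟨ towards-root ⟩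
        M (suc k) * dist u b + suc (M k)                              ≡⟨ cong (λ d → M (suc k) * d + suc (M k)) db ⟩
        M (suc k) * suc m + suc (M k)                                 ≡⟨ identity (M k) m ⟩
        suc (M (suc k) * m + suc (M k) + M k * 2)                     ≡⟨ cong (λ d → suc (M (suc k) * m + suc (M k) + M k * d))
                                                                          (sym (dist-grandchild u e da db)) ⟩
        suc (M (suc k) * m + suc (M k) + M k * dist (parent u b) a)   ≡⟨ cong (λ s → suc (M (suc k) * m + suc (M k) + s))
                                                                          (sym (sdist-replicate k (parent u b) a)) ⟩
        suc (M (suc k) * m + suc (M k) + sdist (parent u b) (replicate k a))
          ≡⟨ cong suc (sym (sdist-∷ (replicate k a) (length-replicate k) db)) ⟩
        suc (sdist u (b ∷ replicate k a))                             ∎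
        where
          identity : ∀ a m → (1 + a + a) * (1 + m) + (1 + a) ≡ 1 + ((1 + a + a) * m + (1 + a) + a * 2)
          identity = solve-∀

  length-swap : ∀ (w : List V) ui uj k → length (w ++ ui ∷ replicate k uj) ≡ length (w ++ uj ∷ replicate k ui)
  length-swap []      ui uj k = cong suc (trans (length-replicate k) (sym (length-replicate k)))
  length-swap (a ∷ w) ui uj k = cong suc (length-swap w ui uj k)

  consCost-mono : ∀ m t {a b a′ b′} → a ≤ suc a′ → b ≤ suc b′ → consCost m t a b ≤ suc (consCost m t a′ b′)
  consCost-mono zero    t a≤ _  = a≤
  consCost-mono (suc m) t {b′ = b′} _ b≤ =
    ≤-trans (+-monoʳ-≤ (M (suc t) * m + suc (M t)) b≤) (≤-reflexive (+-suc _ b′))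

  sdist-edge : ∀ u w {ui uj} k → adj ui uj →
               sdist u (w ++ ui ∷ replicate k uj) ≤ suc (sdist u (w ++ uj ∷ replicate k ui))
  sdist-edge u [] k e with edge-orientation u e
  ... | inj₁ (dui , pui) = ≤-reflexive (sdist-cross u k e dui pui)
  ... | inj₂ (duj , puj) = m≤n⇒m≤1+n (≤-trans (n≤1+n _) (≤-reflexive (sym (sdist-cross u k (adj-sym e) duj puj))))
  sdist-edge u (a ∷ w) {ui} {uj} k e rewrite length-swap w ui uj k =
    consCost-mono (dist u a) _ (sdist-edge u w k e) (sdist-edge (parent u a) w k e)

  -- SAdj G t x y unfolds to SEdge (proj₁ x) (proj₁ y).
  SEdge : List V → List V → Set
  SEdge xs ys = ∃[ w ] ∃[ ui ] ∃[ uj ] ∃[ k ]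
    (adj ui uj × xs ≡ w ++ (ui ∷ replicate k uj) × ys ≡ w ++ (uj ∷ replicate k ui))

  sdist-SEdge : ∀ u {xs ys} → SEdge xs ys → sdist u ys ≤ suc (sdist u xs)
  sdist-SEdge u (w , _ , _ , k , e , refl , refl) = sdist-edge u w k (adj-sym e)

  sdist-walk : ∀ u t {x y k} → Walk (Sierpinski G t) x y k → sdist u (proj₁ y) ≤ k + sdist u (proj₁ x)
  sdist-walk u t here = ≤-refl
  sdist-walk u t {k = suc k} (step e rest) =
    ≤-trans (sdist-walk u t rest) (≤-trans (+-monoʳ-≤ k (sdist-SEdge u e)) (≤-reflexive (+-suc k _)))

  SierpinskiWords : Graph
  SierpinskiWords = record { Vertex = List V ; Adj = SEdge }

  module SW = Walks SierpinskiWords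
  open SW using () renaming (_++ʷ_ to _⨾_)

  prepend : ∀ a {xs ys k} → Walk SierpinskiWords xs ys k → Walk SierpinskiWords (a ∷ xs) (a ∷ ys) k
  prepend a here = here
  prepend a (step (w , ui , uj , k , e , refl , refl) rest) = step ((a ∷ w) , ui , uj , k , e , refl , refl) (prepend a rest)

  cross : ∀ {a b} t → adj a b → Walk SierpinskiWords (a ∷ replicate t b) (b ∷ replicate t a) 1
  cross t e = step ([] , _ , _ , t , e , refl , refl) here

  adjacent-walk : ∀ t {p a} → adj p a → Walk SierpinskiWords (replicate t p) (replicate t a) (M t)
  adjacent-walk zero    e = here
  adjacent-walk (suc t) {p} {a} e =
    SW.castʷ (+-suc (M t) (M t)) (prepend p (adjacent-walk t e) ⨾ (cross t e ⨾ prepend a (adjacent-walk t e)))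

  replicate-walk : ∀ t u a {m} → dist u a ≡ m → Walk SierpinskiWords (replicate t u) (replicate t a) (M t * m)
  replicate-walk t u a {zero} eq =
    subst (λ v → Walk SierpinskiWords (replicate t u) (replicate t v) (M t * 0)) (dist≡0⇒≡ eq)
          (SW.castʷ (sym (*-zeroʳ (M t))) here)
  replicate-walk t u a {suc m} eq =
    SW.castʷ (trans (+-comm (M t * m) (M t)) (sym (*-suc (M t) m)))
      (replicate-walk t u (parent u a) (parent-dist u a eq) ⨾ adjacent-walk t (parent-adj u a eq))

  sdist-path : ∀ x u → Walk SierpinskiWords (replicate (length x) u) x (sdist u x)
  sdist-path []      u = here
  sdist-path (a ∷ x) u = by-cases (dist u a) refl
    where
      t = length x
      by-cases : ∀ k → dist u a ≡ k → Walk SierpinskiWords (u ∷ replicate t u) (a ∷ x) (sdist u (a ∷ x))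
      by-cases zero eq =
        subst (λ v → Walk SierpinskiWords (u ∷ replicate t u) (v ∷ x) (sdist u (a ∷ x))) (dist≡0⇒≡ eq)
              (SW.castʷ (sym (sdist-∷-root x eq)) (prepend u (sdist-path x u)))
      by-cases (suc m) eq =
        SW.castʷ (trans (cong (M (suc t) * m +_) (+-suc (M t) (sdist p x)))
                   (trans (sym (+-assoc (M (suc t) * m) (suc (M t)) (sdist p x))) (sym (sdist-∷ x refl eq))))
          (replicate-walk (suc t) u p (parent-dist u a eq) ⨾
           (prepend p (adjacent-walk t pa) ⨾ (cross t pa ⨾ prepend a (sdist-path x p))))
        where
          p  = parent u a
          pa = parent-adj u a eq

  SEdge-length : ∀ {xs ys} → SEdge xs ys → length xs ≡ length ys
  SEdge-length (w , ui , uj , k , _ , refl , refl) = length-swap w ui uj k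

  toSierpinski : ∀ t {xs ys k} (p : length xs ≡ t) (q : length ys ≡ t) →
                 Walk SierpinskiWords xs ys k → Walk (Sierpinski G t) (xs , p) (ys , q) k
  toSierpinski t {xs} p q here = subst (λ q′ → Walk (Sierpinski G t) (xs , p) (xs , q′) 0) (≡-irrelevant p q) here
  toSierpinski t p q (step e rest) = step e (toSierpinski t (trans (sym (SEdge-length e)) p) q rest)

  sdist-isDist : ∀ u t (x : Word n t) → Dist (Sierpinski G t) (constWord u t) x (sdist u (proj₁ x))
  sdist-isDist u .(length xs) (xs , refl) =
    toSierpinski (length xs) (length-replicate (length xs)) refl (sdist-path xs u) ,
    λ k w → ≤-trans (sdist-walk u _ w) (≤-reflexive (trans (cong (k +_) start) (+-identityʳ k)))
    where
      start : sdist u (replicate (length xs) u) ≡ 0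
      start = trans (sdist-replicate (length xs) u u) (trans (cong (M (length xs) *_) (dist-refl u)) (*-zeroʳ (M (length xs))))

module SierpinskiEccentricity {n : ℕ} (G : SimpleGraph n) (acyclic : Acyclic (toGraph G))
                              {D : ℕ} (diam : Diam (toGraph G) D) {D′ : ℕ} (D≡2+D′ : D ≡ 2 + D′) where

  open TreeDistance G acyclic diam
  open SierpinskiDistance G acyclic diam

  dist≤2+D′ : ∀ u v → dist u v ≤ 2 + D′
  dist≤2+D′ u v = subst (dist u v ≤_) D≡2+D′ (dist≤D u v)

  -- Unless it is v itself, the parent of a has two neighbours (a and its own parent), so it is not a leaf.
  parent-dist<D : ∀ {v a m} → (∀ z → dist v z ≤ suc m) → dist v a ≡ suc m → ∀ z → dist (parent v a) z ≤ suc D′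
  parent-dist<D {v} {a} {zero} ecc eq z =
    subst (λ p → dist p z ≤ suc D′) (dist≡0⇒≡ (parent-dist v a eq)) (≤-trans (ecc z) (s≤s z≤n))
  parent-dist<D {v} {a} {suc m} ecc eq z =
    ≤-pred (subst (dist (parent v a) z <_) D≡2+D′
      (internal⇒dist<D (adj-sym (parent-adj v a eq)) (parent-adj v p dp) a≢pp z))
    where
      p  = parent v a
      dp = parent-dist v a eq
      a≢pp : a ≢ parent v p
      a≢pp a≡pp = m≢1+n+m m {1} (trans (sym (parent-dist v p dp)) (trans (cong (dist v) (sym a≡pp)) eq))

  sdist-bound : ∀ x v c → (∀ z → dist v z ≤ c) → sdist v x ≤ M (length x) * c + N (length x) * D′
  sdist-bound []      v c ecc = z≤n
  sdist-bound (a ∷ x) v c ecc = by-cases (dist v a) refl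
    where
      open ≤-Reasoning
      t = length x
      by-cases : ∀ k → dist v a ≡ k → sdist v (a ∷ x) ≤ M (suc t) * c + N (suc t) * D′
      by-cases zero eq = begin
        sdist v (a ∷ x)                ≡⟨ sdist-∷-root x eq ⟩
        sdist v x                      ≤⟨ sdist-bound x v c ecc ⟩
        M t * c + N t * D′             ≤⟨ +-mono-≤ (*-monoˡ-≤ c (M-mono t)) (*-monoˡ-≤ D′ (N-mono t)) ⟩
        M (suc t) * c + N (suc t) * D′ ∎
      by-cases (suc m) eq with suc m ≟ c
      ... | yes m+1≡c = begin
        sdist v (a ∷ x)                                       ≡⟨ sdist-∷ x refl eq ⟩
        M (suc t) * m + suc (M t) + sdist (parent v a) x      ≤⟨ +-monoʳ-≤ _ (sdist-bound x _ (suc D′) (parent-dist<D ecc′ eq)) ⟩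
        M (suc t) * m + suc (M t) + (M t * suc D′ + N t * D′) ≡⟨ M-N-step t m D′ ⟩
        M (suc t) * suc m + N (suc t) * D′                    ≡⟨ cong (λ c → M (suc t) * c + N (suc t) * D′) m+1≡c ⟩
        M (suc t) * c + N (suc t) * D′                        ∎
        where ecc′ = λ z → subst (dist v z ≤_) (sym m+1≡c) (ecc z)
      ... | no m+1≢c = begin
        sdist v (a ∷ x)                                          ≡⟨ sdist-∷ x refl eq ⟩
        M (suc t) * m + suc (M t) + sdist (parent v a) x         ≤⟨ +-monoʳ-≤ _ (sdist-bound x _ (2 + D′) (dist≤2+D′ _)) ⟩
        M (suc t) * m + suc (M t) + (M t * (2 + D′) + N t * D′) ≤⟨ M-N-step-≤ t m D′ (c ∸ (2 + m)) ⟩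
        M (suc t) * (2 + m + (c ∸ (2 + m))) + N (suc t) * D′    ≡⟨ cong (λ c → M (suc t) * c + N (suc t) * D′) m+2+r≡c ⟩
        M (suc t) * c + N (suc t) * D′                           ∎
        where m+2+r≡c = m+[n∸m]≡n (≤∧≢⇒< (subst (_≤ c) eq (ecc a)) m+1≢c)

  neighbour-of-diametral : ∀ {y z q} → dist y z ≡ D → adj q y → dist q z ≡ suc D′
  neighbour-of-diametral {y} {z} {q} dyz e =
    trans (dist-sym q z) (suc-injective (trans (sym (proj₁ (farthest-neighbour farthest e))) dzy))
    where
      dzy : dist z y ≡ 2 + D′
      dzy = trans (dist-sym z y) (trans dyz D≡2+D′)
      farthest : ∀ x → dist z x ≤ dist z y
      farthest x = subst (dist z x ≤_) (sym dzy) (dist≤2+D′ z x)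

  alternating : V → V → ℕ → List V
  alternating a w zero    = []
  alternating a w (suc t) = a ∷ alternating w a t

  length-alternating : ∀ t a w → length (alternating a w t) ≡ t
  length-alternating zero    a w = refl
  length-alternating (suc t) a w = cong suc (length-alternating t w a)

  sdist-alternating : ∀ t {u a w m} → dist a w ≡ D → dist u a ≡ suc m →
                      sdist u (alternating a w t) ≡ M t * suc m + N t * D′
  sdist-alternating zero    _   _  = refl
  sdist-alternating (suc t) {u} {a} {w} {m} daw dua = begin
    sdist u (a ∷ alternating w a t)                                  ≡⟨ sdist-∷ (alternating w a t) (length-alternating t w a) dua ⟩
    M (suc t) * m + suc (M t) + sdist (parent u a) (alternating w a t) ≡⟨ cong (M (suc t) * m + suc (M t) +_) rest ⟩
    M (suc t) * m + suc (M t) + (M t * suc D′ + N t * D′)            ≡⟨ M-N-step t m D′ ⟩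
    M (suc t) * suc m + N (suc t) * D′                               ∎
    where
      open ≡-Reasoning
      rest = sdist-alternating t (trans (dist-sym w a) daw) (neighbour-of-diametral daw (parent-adj u a dua))

  ecc-positive : ∀ {u e} → (∀ v → dist u v ≤ e) → 1 ≤ e
  ecc-positive {u} {e} ecc with proj₂ diam
  ... | y , z , y-z = half (begin
    2 + D′              ≡⟨ sym (trans (Dist⇒dist≡ y-z) D≡2+D′) ⟩
    dist y z            ≤⟨ dist-triangle y u z ⟩
    dist y u + dist u z ≤⟨ +-mono-≤ (subst (_≤ e) (dist-sym u y) (ecc y)) (ecc z) ⟩
    e + e               ∎)
    where
      open ≤-Reasoning
      half : ∀ {e} → 2 + D′ ≤ e + e → 1 ≤ e
      half {suc _} _ = s≤s z≤n

  sierpinski-ecc : ∀ u e t → Ecc (toGraph G) u e → Ecc (Sierpinski G t) (constWord u t) (M t * e + N t * D′)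
  sierpinski-ecc u e t (ecc , a , ua) = bounded , attained
    where
      dist≤e : ∀ v → dist u v ≤ e
      dist≤e v with ecc v
      ... | _ , d , d≤e = subst (_≤ e) (sym (Dist⇒dist≡ d)) d≤e
      bounded : ∀ x → ∃[ d ] (Dist (Sierpinski G t) (constWord u t) x d × d ≤ M t * e + N t * D′)
      bounded (xs , refl) = sdist u xs , sdist-isDist u (length xs) (xs , refl) , sdist-bound xs u e dist≤e
      dua : dist u a ≡ e
      dua = Dist⇒dist≡ ua
      e≡1+e∸1 : e ≡ suc (e ∸ 1)
      e≡1+e∸1 = sym (m+[n∸m]≡n (ecc-positive dist≤e))
      attained : ∃[ x ] Dist (Sierpinski G t) (constWord u t) x (M t * e + N t * D′)
      attained with farthest-is-peripheral (λ v → subst (dist u v ≤_) (sym dua) (dist≤e v))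
      ... | w , daw = far , subst (Dist (Sierpinski G t) (constWord u t) far) sdist-far (sdist-isDist u t far)
        where
          far : Word n t
          far = alternating a w t , length-alternating t a w
          sdist-far : sdist u (alternating a w t) ≡ M t * e + N t * D′
          sdist-far = trans (sdist-alternating t daw (trans dua e≡1+e∸1))
                            (cong (λ k → M t * k + N t * D′) (sym e≡1+e∸1))

theorem13 : (n : ℕ) → (T : SimpleGraph n) → IsTree T → 3 ≤ n →
    (u : Fin n) → (t : ℕ) → 1 ≤ t → (e D : ℕ) →
    Ecc (toGraph T) u e → Diam (toGraph T) D →
    Ecc (Sierpinski T t) (constWord u t)
      ((2 ^ t ∸ 1) * e + (2 ^ t ∸ t ∸ 1) * (D ∸ 2))
theorem13 _ T (_ , acyclic) (s≤s (s≤s (s≤s _))) u t _ e D ecc diam =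
  subst (Ecc (Sierpinski T t) (constWord u t)) closed-form (sierpinski-ecc u e t ecc)
  where
    2≤D : 2 ≤ D
    2≤D = TreeDistance.three-distinct⇒2≤D T acyclic diam {zero} {suc zero} {suc (suc zero)} (λ ()) (λ ()) (λ ())
    open SierpinskiEccentricity T acyclic diam (sym (m+[n∸m]≡n 2≤D))
    closed-form : M t * e + N t * (D ∸ 2) ≡ (2 ^ t ∸ 1) * e + (2 ^ t ∸ t ∸ 1) * (D ∸ 2)
    closed-form = cong₂ (λ a b → a * e + b * (D ∸ 2)) (M≡2^∸1 t) (N≡2^∸t∸1 t)
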